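{- Let $G$ be a graph with a proper edge coloring, let $k\ge1$, and assume $G$ has no $k'$-fast walk for any $2\le k'\le k$. Then the $(k-1)$-shaving of $G$ (with the inherited coloring) is $k$-flat.
   Context: Graphs are simple and finite; a proper edge coloring gives adjacent edges distinct colors from a linearly ordered set. A walk of length $m$ is $v_0,\dots,v_m$ with $v_{i-1}v_i$ edges and $v_{i-2}\ne v_i$; its coloring is $(c_1,\dots,c_m)=(\chi(v_0v_1),\dots,\chi(v_{m-1}v_m))$. For $k\ge 2$, a $k$-fast walk is a walk of length $2k$ with $c_1>c_2>\dots>c_k<c_{k+1}<\dots<c_{2k}$ and $c_1\ge c_{2k}$. The shaving of $G$ is the subgraph obtained by deleting, for every non-isolated vertex, the edge of largest color incident to it; the $j$-shaving is obtained by applying shaving $j$ times (the $0$-shaving is $G$). The height function of a walk $W$ is $h_W(1)=0$, $h_W(i+1)=h_W(i)+1$ if $c_{i+1}>c_i$ and $h_W(i+1)=h_W(i)-1$ if $c_{i+1}<c_i$. A properly edge colored graph is $k$-flat if for every walk $W$ of length $m\ge2$ with $h_W(i)<0$ for all $2\le i\le m$: if $m\le 2k+1$ or $h_W(i)\ge-k$ for all $i$, then $c_1>c_m$. -}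

module Defs where

open import Data.Nat using (ℕ; zero; suc; _+_; _*_; _∸_; _≤_; _<_; _<?_)
open import Data.Integer using (ℤ; +_; -_) renaming (_+_ to _+ℤ_; _-_ to _-ℤ_)
open import Data.Fin using (Fin)
open import Data.Product using (_×_; Σ)
open import Data.Sum using (_⊎_)
open import Relation.Nullary using (¬_; yes; no)
open import Relation.Binary.PropositionalEquality using (_≡_; _≢_)

Rel : ℕ → Set₁
Rel n = Fin n → Fin n → Set

-- Edge colouring: a colour (from the linear order ℕ) for each pair of vertices;
-- only values on edges matter.
Colouring : ℕ → Set
Colouring n = Fin n → Fin n → ℕ

IsSimpleGraph : ∀ {n} → Rel n → Set
IsSimpleGraph {n} E = (∀ (u v : Fin n) → E u v → E v u) × (∀ (u : Fin n) → ¬ E u u)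

IsProperColouring : ∀ {n} → Rel n → Colouring n → Set
IsProperColouring {n} E χ =
  (∀ (u v : Fin n) → E u v → χ u v ≡ χ v u) ×
  (∀ (u v w : Fin n) → E u v → E u w → v ≢ w → χ u v ≢ χ u w)

-- Walks of length m, as a vertex sequence v₀, v₁, … (only v₀ … v_m matter).
IsWalk : ∀ {n} → Rel n → ℕ → (ℕ → Fin n) → Set
IsWalk E m v =
  (∀ i → 1 ≤ i → i ≤ m → E (v (i ∸ 1)) (v i)) ×
  (∀ i → 2 ≤ i → i ≤ m → v (i ∸ 2) ≢ v i)

colours : ∀ {n} → Colouring n → (ℕ → Fin n) → ℕ → ℕ
colours χ v i = χ (v (i ∸ 1)) (v i)

-- k-fast walk (k ≥ 2 is imposed where used)
IsFastWalk : ∀ {n} → Rel n → Colouring n → ℕ → (ℕ → Fin n) → Set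
IsFastWalk E χ k v = let c = colours χ v in
  IsWalk E (2 * k) v ×
  (∀ i → 1 ≤ i → i < k → c (suc i) < c i) ×
  (∀ i → k ≤ i → i < 2 * k → c i < c (suc i)) ×
  (c (2 * k) ≤ c 1)

HasFastWalk : ∀ {n} → Rel n → Colouring n → ℕ → Set
HasFastWalk E χ k = Σ _ λ v → IsFastWalk E χ k v

-- Height function of a colour sequence: h 1 = 0,
-- h (i+1) = h i + 1 if c (i+1) > c i, and h i - 1 otherwise
-- (for walks in a properly coloured graph consecutive colours differ).
height : (ℕ → ℕ) → ℕ → ℤ
height c zero = + 0
height c (suc zero) = + 0
height c (suc (suc i)) = step (c (suc i)) (c (suc (suc i))) (height c (suc i))
  where
  step : ℕ → ℕ → ℤ → ℤ
  step a b h with a <? b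
  ... | yes _ = h +ℤ + 1
  ... | no  _ = h -ℤ + 1

IsMaxEdgeAt : ∀ {n} → Rel n → Colouring n → Fin n → Fin n → Set
IsMaxEdgeAt E χ u v = E u v × (∀ w → E u w → χ u w ≤ χ u v)

shave : ∀ {n} → Colouring n → Rel n → Rel n
shave χ E u v = E u v × ¬ IsMaxEdgeAt E χ u v × ¬ IsMaxEdgeAt E χ v u

shaveN : ∀ {n} → Colouring n → ℕ → Rel n → Rel n
shaveN χ zero E = E
shaveN χ (suc j) E = shave χ (shaveN χ j E)

IsFlat : ∀ {n} → Rel n → Colouring n → ℕ → Set
IsFlat E χ k =
  ∀ m v → let c = colours χ v in
  2 ≤ m → IsWalk E m v →
  (∀ i → 2 ≤ i → i ≤ m → height c i Data.Integer.< + 0) →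
  (m ≤ 2 * k + 1 ⊎ (∀ i → 1 ≤ i → i ≤ m → (- (+ k)) Data.Integer.≤ height c i)) →
  c m < c 1

-- A counterexample is a walk in S whose height stays negative, with
-- c₁ ≤ c_m, satisfying one of the two flatness side conditions.  Either
-- side condition implies that the height never rises by more than K
-- (rises-of-short-walk, rises-of-shallow-walk).  We then prove, by
-- induction on the length, that there is no "obstruction": a walk in G
-- with negative height, c₁ ≤ c_m, rises at most K, all of whose peak
-- edges lie in S.  Take the last peak edge; being in the K-shaving, it
-- starts an ascending chain of D ≤ K edges of larger colours (chains are
-- built by unfolding the definition of shaving).  If the chain ends above
-- c₁, replacing the tail of the walk by the chain gives a shorter
-- obstruction.  Otherwise the reversed chain followed by the tail of the
-- walk is a peak-free walk with a valley, and reading its last 2k' edges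
-- backwards gives a k'-fast walk with k' ≤ k (valley lemma).
module Submission where

open import Defs
open import Data.Nat using (ℕ; zero; suc; _+_; _∸_; _*_; _≤_; _<_; _<?_; _≤?_; z≤n; s≤s)
import Data.Nat.Properties as ℕP
open import Data.Nat.Tactic.RingSolver using (solve-∀)
open import Data.Integer as ℤ using (ℤ; +_; -[1+_]; -_)
  renaming (_+_ to _+ℤ_; _≤_ to _≤ℤ_; _<_ to _<ℤ_)
import Data.Integer.Properties as ℤP
open import Data.Fin using (Fin)
open import Data.Product using (_×_; _,_; Σ; proj₁; proj₂)
open import Data.Sum using (_⊎_; inj₁; inj₂; [_,_]′)
open import Data.Empty using (⊥; ⊥-elim)
open import Relation.Nullary using (¬_; yes; no; Dec; _×-dec_)
open import Relation.Nullary.Decidable using (decidable-stable)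
open import Relation.Binary.PropositionalEquality

+-cancelˡ-≤ℤ : ∀ x {a b} → x +ℤ a ≤ℤ x +ℤ b → a ≤ℤ b
+-cancelˡ-≤ℤ x {a} {b} h = subst₂ _≤ℤ_ (cancel a) (cancel b) (ℤP.+-monoʳ-≤ (- x) h)
  where
  cancel : ∀ a → - x +ℤ (x +ℤ a) ≡ a
  cancel a = begin
    - x +ℤ (x +ℤ a)   ≡⟨ sym (ℤP.+-assoc (- x) x a) ⟩
    (- x +ℤ x) +ℤ a   ≡⟨ cong (_+ℤ a) (ℤP.+-inverseˡ x) ⟩
    + 0 +ℤ a          ≡⟨ ℤP.+-identityˡ a ⟩
    a                 ∎
    where open ≡-Reasoning

-+<0⇒< : ∀ a b → - (+ a) +ℤ + b <ℤ + 0 → b < a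
-+<0⇒< a b h with a ≤? b
... | no a≰b = ℕP.≰⇒> a≰b
... | yes a≤b = ⊥-elim (ℤP.<-irrefl refl (ℤP.≤-<-trans (ℤ.+≤+ z≤n)
                  (subst (_<ℤ + 0) (trans (ℤP.-m+n≡n⊖m a b) (ℤP.⊖-≥ a≤b)) h)))

≤⇒difference : ∀ x y → x ≤ℤ y → Σ ℕ λ d → y ≡ x +ℤ + d
≤⇒difference x y h = ℤ.∣ y ℤ.- x ∣ , sym (begin
    x +ℤ + ℤ.∣ y ℤ.- x ∣   ≡⟨ cong (x +ℤ_) (ℤP.0≤i⇒+∣i∣≡i (ℤP.i≤j⇒0≤j-i h)) ⟩
    x +ℤ (y +ℤ - x)        ≡⟨ cong (x +ℤ_) (ℤP.+-comm y (- x)) ⟩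
    x +ℤ (- x +ℤ y)        ≡⟨ sym (ℤP.+-assoc x (- x) y) ⟩
    (x +ℤ - x) +ℤ y        ≡⟨ cong (_+ℤ y) (ℤP.+-inverseʳ x) ⟩
    + 0 +ℤ y               ≡⟨ ℤP.+-identityˡ y ⟩
    y                      ∎)
  where open ≡-Reasoning

-1-suc : ∀ n → -[1+ 0 ] +ℤ - (+ n) ≡ - (+ suc n)
-1-suc zero = refl
-1-suc (suc n) = refl

+∸-≤ : ∀ a b c → a + b ≤ c → a ≤ c ∸ b
+∸-≤ a b c h = subst (_≤ c ∸ b) (ℕP.m+n∸n≡m a b) (ℕP.∸-monoˡ-≤ b h)

∸-≤+ : ∀ c b a → c ≤ a + b → c ∸ b ≤ a
∸-≤+ c b a h = subst (c ∸ b ≤_) (ℕP.m+n∸n≡m a b) (ℕP.∸-monoˡ-≤ b h)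

∸-<-self : ∀ c i → 1 ≤ i → i ≤ c → c ∸ i < c
∸-<-self c i 1≤i i≤c = ℕP.∸-monoʳ-< {c} {i} {0} 1≤i i≤c

∸-suc : ∀ M i → i < M → M ∸ i ≡ suc (M ∸ suc i)
∸-suc (suc M) zero _ = refl
∸-suc (suc M) (suc i) (s≤s i<M) = ∸-suc M i i<M

≤-or-beyond : ∀ a i → i ≤ a ⊎ Σ ℕ (λ t → i ≡ a + suc t)
≤-or-beyond a i with i ≤? a
... | yes i≤a = inj₁ i≤a
... | no i≰a with ℕP.m≤n⇒∃[o]m+o≡n (ℕP.≰⇒> i≰a)
...   | t , eq = inj₂ (t , trans (sym eq) (sym (ℕP.+-suc a t)))

slope : ℕ → ℕ → ℤ
slope a b with a <? b
... | yes _ = + 1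
... | no _ = -[1+ 0 ]

slope-up : ∀ {a b} → a < b → slope a b ≡ + 1
slope-up {a} {b} a<b with a <? b
... | yes _ = refl
... | no a≮b = ⊥-elim (a≮b a<b)

slope-down : ∀ {a b} → ¬ (a < b) → slope a b ≡ -[1+ 0 ]
slope-down {a} {b} a≮b with a <? b
... | yes a<b = ⊥-elim (a≮b a<b)
... | no _ = refl

slope≤1 : ∀ a b → slope a b ≤ℤ + 1
slope≤1 a b with a <? b
... | yes _ = ℤP.≤-refl
... | no _ = ℤ.-≤+

-1≤slope : ∀ a b → -[1+ 0 ] ≤ℤ slope a b
-1≤slope a b with a <? b
... | yes _ = ℤ.-≤+
... | no _ = ℤP.≤-refl

height-step : ∀ c i → height c (suc (suc i)) ≡ height c (suc i) +ℤ slope (c (suc i)) (c (suc (suc i)))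
height-step c i with c (suc i) <? c (suc (suc i))
... | yes _ = refl
... | no _ = refl

gain : (ℕ → ℕ) → ℕ → ℕ → ℤ
gain c a zero = + 0
gain c a (suc n) = slope (c a) (c (suc a)) +ℤ gain c (suc a) n

height-gain : ∀ c a n → height c (suc a + n) ≡ height c (suc a) +ℤ gain c (suc a) n
height-gain c a zero rewrite ℕP.+-identityʳ a = sym (ℤP.+-identityʳ _)
height-gain c a (suc n) rewrite ℕP.+-suc a n = begin
    height c (suc (suc a) + n)
  ≡⟨ height-gain c (suc a) n ⟩
    height c (suc (suc a)) +ℤ gain c (suc (suc a)) n
  ≡⟨ cong (_+ℤ gain c (suc (suc a)) n) (height-step c a) ⟩
    (height c (suc a) +ℤ slope (c (suc a)) (c (suc (suc a)))) +ℤ gain c (suc (suc a)) n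
  ≡⟨ ℤP.+-assoc (height c (suc a)) _ _ ⟩
    height c (suc a) +ℤ gain c (suc a) (suc n)
  ∎
  where open ≡-Reasoning

gain-cong : ∀ c c′ a a′ n → (∀ i → i ≤ n → c (a + i) ≡ c′ (a′ + i)) → gain c a n ≡ gain c′ a′ n
gain-cong c c′ a a′ zero eq = refl
gain-cong c c′ a a′ (suc n) eq =
  cong₂ _+ℤ_ (cong₂ slope first second) (gain-cong c c′ (suc a) (suc a′) n shifted)
  where
  at : ∀ i → c (a + i) ≡ c′ (a′ + i) → ∀ {x x′} → a + i ≡ x → a′ + i ≡ x′ → c x ≡ c′ x′
  at i e refl refl = e
  first : c a ≡ c′ a′
  first = at 0 (eq 0 z≤n) (ℕP.+-identityʳ a) (ℕP.+-identityʳ a′)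
  second : c (suc a) ≡ c′ (suc a′)
  second = at 1 (eq 1 (s≤s z≤n)) (ℕP.+-comm a 1) (ℕP.+-comm a′ 1)
  shifted : ∀ i → i ≤ n → c (suc a + i) ≡ c′ (suc a′ + i)
  shifted i i≤n = at (suc i) (eq (suc i) (s≤s i≤n)) (ℕP.+-suc a i) (ℕP.+-suc a′ i)

height-cong : ∀ c c′ L → (∀ t → 1 ≤ t → t ≤ L → c t ≡ c′ t) →
  ∀ j → 1 ≤ j → j ≤ L → height c j ≡ height c′ j
height-cong c c′ L agree (suc j) _ sj≤L = begin
  height c (suc j)             ≡⟨ height-gain c 0 j ⟩
  + 0 +ℤ gain c 1 j            ≡⟨ cong (+ 0 +ℤ_) (gain-cong c c′ 1 1 j agree′) ⟩
  + 0 +ℤ gain c′ 1 j           ≡⟨ sym (height-gain c′ 0 j) ⟩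
  height c′ (suc j)            ∎
  where
  open ≡-Reasoning
  agree′ : ∀ i → i ≤ j → c (suc i) ≡ c′ (suc i)
  agree′ i i≤j = agree (suc i) (s≤s z≤n) (ℕP.≤-trans (s≤s i≤j) sj≤L)

gain-ascending : ∀ c a n → (∀ i → i < n → c (a + i) < c (suc (a + i))) → gain c a n ≡ + n
gain-ascending c a zero _ = refl
gain-ascending c a (suc n) up =
  trans (cong₂ _+ℤ_ (slope-up first) (gain-ascending c (suc a) n rest)) (sym (ℤP.pos-+ 1 n))
  where
  first : c a < c (suc a)
  first = subst (λ x → c x < c (suc x)) (ℕP.+-identityʳ a) (up 0 (s≤s z≤n))
  rest : ∀ i → i < n → c (suc a + i) < c (suc (suc a + i))
  rest i i<n = subst (λ x → c x < c (suc x)) (ℕP.+-suc a i) (up (suc i) (s≤s i<n))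

gain-descending : ∀ c a n → (∀ i → i < n → ¬ (c (a + i) < c (suc (a + i)))) → gain c a n ≡ - (+ n)
gain-descending c a zero _ = refl
gain-descending c a (suc n) down =
  trans (cong₂ _+ℤ_ (slope-down first) (gain-descending c (suc a) n rest)) (-1-suc n)
  where
  first : ¬ (c a < c (suc a))
  first = subst (λ x → ¬ (c x < c (suc x))) (ℕP.+-identityʳ a) (down 0 (s≤s z≤n))
  rest : ∀ i → i < n → ¬ (c (suc a + i) < c (suc (suc a + i)))
  rest i i<n = subst (λ x → ¬ (c x < c (suc x))) (ℕP.+-suc a i) (down (suc i) (s≤s i<n))

gain≤length : ∀ c a n → gain c a n ≤ℤ + n
gain≤length c a zero = ℤP.≤-refl
gain≤length c a (suc n) = subst (gain c a (suc n) ≤ℤ_) (sym (ℤP.pos-+ 1 n))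
  (ℤP.+-mono-≤ (slope≤1 (c a) (c (suc a))) (gain≤length c (suc a) n))

-length≤gain : ∀ c a n → - (+ n) ≤ℤ gain c a n
-length≤gain c a zero = ℤP.≤-refl
-length≤gain c a (suc n) = subst (_≤ℤ gain c a (suc n)) (-1-suc n)
  (ℤP.+-mono-≤ (-1≤slope (c a) (c (suc a))) (-length≤gain c (suc a) n))

least : (P : ℕ → Set) → (∀ i → Dec (P i)) → ∀ N →
  (∀ i → i < N → ¬ P i) ⊎ Σ ℕ (λ i → i < N × P i × (∀ j → j < i → ¬ P j))
least P P? zero = inj₁ (λ i ())
least P P? (suc N) with least P P? N
... | inj₂ (i , i<N , p , before) = inj₂ (i , ℕP.m≤n⇒m≤1+n i<N , p , before)
... | inj₁ none with P? N
...   | yes p = inj₂ (N , ℕP.n<1+n N , p , none)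
...   | no ¬p = inj₁ noneBelowSuc
  where
  noneBelowSuc : ∀ i → i < suc N → ¬ P i
  noneBelowSuc i i<sN with ℕP.m≤n⇒m<n∨m≡n (ℕP.≤-pred i<sN)
  ... | inj₁ i<N = none i i<N
  ... | inj₂ refl = ¬p

greatest : (P : ℕ → Set) → (∀ i → Dec (P i)) → ∀ N →
  (∀ i → i < N → ¬ P i) ⊎ Σ ℕ (λ i → i < N × P i × (∀ j → i < j → j < N → ¬ P j))
greatest P P? zero = inj₁ (λ i ())
greatest P P? (suc N) with P? N
... | yes p = inj₂ (N , ℕP.n<1+n N , p , λ j N<j j<sN → ⊥-elim (ℕP.<-irrefl refl (ℕP.<-≤-trans N<j (ℕP.≤-pred j<sN))))
... | no ¬p = extend (greatest P P? N)
  where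
  upToN : ∀ {i} → i < suc N → i < N ⊎ i ≡ N
  upToN i<sN = ℕP.m≤n⇒m<n∨m≡n (ℕP.≤-pred i<sN)
  extend : (∀ i → i < N → ¬ P i) ⊎ Σ ℕ (λ i → i < N × P i × (∀ j → i < j → j < N → ¬ P j)) →
    (∀ i → i < suc N → ¬ P i) ⊎ Σ ℕ (λ i → i < suc N × P i × (∀ j → i < j → j < suc N → ¬ P j))
  extend (inj₁ none) = inj₁ λ i i<sN → [ none i , (λ { refl → ¬p }) ]′ (upToN i<sN)
  extend (inj₂ (i , i<N , p , after)) = inj₂ (i , ℕP.m≤n⇒m≤1+n i<N , p ,
    λ j i<j j<sN → [ after j i<j , (λ { refl → ¬p }) ]′ (upToN j<sN))

StaysNegative : (ℕ → ℕ) → ℕ → Set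
StaysNegative c m = ∀ i → 2 ≤ i → i ≤ m → height c i <ℤ + 0

RisesAtMost : ℕ → (ℕ → ℕ) → ℕ → Set
RisesAtMost K c m = ∀ a b → 1 ≤ a → a ≤ b → b ≤ m → height c b ≤ℤ height c a +ℤ + K

-- A negative excursion of depth at most K + 1 rises at most K: after index
-- 1 every height lies in [−(K+1), −1], and height 1 is 0.
rises-of-shallow-walk : ∀ K c m → StaysNegative c m →
  (∀ i → 1 ≤ i → i ≤ m → - (+ suc K) ≤ℤ height c i) → RisesAtMost K c m
rises-of-shallow-walk K c m neg low (suc zero) (suc zero) _ _ _ = ℤ.+≤+ z≤n
rises-of-shallow-walk K c m neg low (suc zero) (suc (suc b)) _ _ b≤m =
  ℤP.≤-trans (ℤP.<⇒≤ (neg (suc (suc b)) (s≤s (s≤s z≤n)) b≤m)) (ℤ.+≤+ z≤n)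
rises-of-shallow-walk K c m neg low (suc (suc a)) b _ a≤b b≤m =
  ℤP.≤-trans (ℤP.i<j⇒i≤pred[j] (neg b (ℕP.≤-trans (s≤s (s≤s z≤n)) a≤b) b≤m))
    (subst (_≤ℤ height c (suc (suc a)) +ℤ + K) -[1+K]+K≡-1
      (ℤP.+-monoˡ-≤ (+ K) (low (suc (suc a)) (s≤s z≤n) (ℕP.≤-trans a≤b b≤m))))
  where
  -[1+K]+K≡-1 : - (+ suc K) +ℤ + K ≡ -[1+ 0 ]
  -[1+K]+K≡-1 = trans (ℤP.-m+n≡n⊖m (suc K) K)
    (trans (ℤP.⊖-< (ℕP.n<1+n K)) (cong (λ x → - (+ x)) (ℕP.m+n∸n≡m 1 K)))

-- A rise from
-- a to b over more than K steps is bounded by the a − 1 steps before a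
-- (height a ≥ −(a−1)) plus the m − b steps after b (height b < m − b).
rises-of-short-walk : ∀ K c m → 2 ≤ m → StaysNegative c m → m ≤ 2 * suc K + 1 → RisesAtMost K c m
rises-of-short-walk K c m 2≤m neg m≤ (suc a′) b _ a≤b b≤m
  with ℕP.m≤n⇒∃[o]m+o≡n a≤b | ℕP.m≤n⇒∃[o]m+o≡n b≤m
... | d , refl | e , refl with d ≤? K
...   | yes d≤K = subst (_≤ℤ ha +ℤ + K) (sym (height-gain c a′ d))
                    (ℤP.+-monoʳ-≤ ha (ℤP.≤-trans (gain≤length c (suc a′) d) (ℤ.+≤+ d≤K)))
  where
  ha : ℤ
  ha = height c (suc a′)
...   | no d≰K = hb≤ha+K
  where
  hb ha : ℤ
  hb = height c (suc a′ + d)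
  ha = height c (suc a′)
  hb<e : hb <ℤ + e
  hb<e = subst₂ _<ℤ_ (trans (ℤP.+-assoc hb (- (+ e)) (+ e)) (trans (cong (hb +ℤ_) (ℤP.+-inverseˡ (+ e))) (ℤP.+-identityʳ hb)))
           (ℤP.+-identityˡ (+ e))
           (ℤP.+-monoˡ-< (+ e) (ℤP.≤-<-trans (ℤP.+-monoʳ-≤ hb (-length≤gain c (suc (a′ + d)) e))
             (subst (_<ℤ + 0) (height-gain c (a′ + d) e) (neg (suc a′ + d + e) 2≤m ℕP.≤-refl))))
  ha≥-a′ : - (+ a′) ≤ℤ ha
  ha≥-a′ = subst (- (+ a′) ≤ℤ_) (sym (trans (height-gain c 0 a′) (ℤP.+-identityˡ _))) (-length≤gain c 1 a′)
  lengths : ∀ a d e → suc a + d + e ≡ d + suc (a + e)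
  lengths = solve-∀
  bound : ∀ K → 2 * suc K + 1 ≡ suc K + suc (suc K)
  bound = solve-∀
  e+a′≤1+K : e + a′ ≤ suc K
  e+a′≤1+K = subst (_≤ suc K) (ℕP.+-comm a′ e) (ℕP.≤-pred (ℕP.+-cancelˡ-≤ (suc K) _ _
    (ℕP.≤-trans (ℕP.+-monoˡ-≤ (suc (a′ + e)) (ℕP.≰⇒> d≰K)) (subst₂ _≤_ (lengths a′ d e) (bound K) m≤))))
  hb+a′≤K : hb +ℤ + a′ ≤ℤ + K
  hb+a′≤K = +-cancelˡ-≤ℤ (+ 1) (subst (+ 1 +ℤ (hb +ℤ + a′) ≤ℤ_) (ℤP.pos-+ 1 K) (ℤP.i<j⇒suc[i]≤j
    (ℤP.<-≤-trans (ℤP.+-monoˡ-< (+ a′) hb<e) (subst (_≤ℤ + suc K) (ℤP.pos-+ e a′) (ℤ.+≤+ e+a′≤1+K)))))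
  hb≤ha+K : hb ≤ℤ ha +ℤ + K
  hb≤ha+K = subst₂ _≤ℤ_
    (trans (ℤP.+-assoc hb (+ a′) (- (+ a′))) (trans (cong (hb +ℤ_) (ℤP.+-inverseʳ (+ a′))) (ℤP.+-identityʳ hb)))
    (ℤP.+-comm (+ K) ha)
    (ℤP.+-mono-≤ hb+a′≤K ha≥-a′)

module Walks {n : ℕ} (E : Rel n) (χ : Colouring n)
  (E-sym : ∀ u v → E u v → E v u)
  (χ-sym : ∀ u v → E u v → χ u v ≡ χ v u)
  (χ-proper : ∀ u v w → E u v → E u w → v ≢ w → χ u v ≢ χ u w) where

  col : (ℕ → Fin n) → ℕ → ℕ
  col = colours χ

  walk-prefix : ∀ {m m′} {v} → m′ ≤ m → IsWalk E m v → IsWalk E m′ v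
  walk-prefix m′≤m (edge , noBack) =
    (λ i a b → edge i a (ℕP.≤-trans b m′≤m)) , (λ i a b → noBack i a (ℕP.≤-trans b m′≤m))

  -- Consecutive edges of a walk are adjacent and distinct, so their
  -- colours differ; hence a non-rise is a strict descent.
  consecutive-colours-differ : ∀ {m v} → IsWalk E m v → ∀ i → 1 ≤ i → suc i ≤ m → col v i ≢ col v (suc i)
  consecutive-colours-differ {m} {v} (edge , noBack) (suc i) _ si≤m eq =
    χ-proper (v (suc i)) (v i) (v (suc (suc i)))
      (E-sym _ _ (edge (suc i) (s≤s z≤n) (ℕP.<⇒≤ si≤m)))
      (edge (suc (suc i)) (s≤s z≤n) si≤m)
      (noBack (suc (suc i)) (s≤s (s≤s z≤n)) si≤m)
      (trans (sym (χ-sym _ _ (edge (suc i) (s≤s z≤n) (ℕP.<⇒≤ si≤m)))) eq)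

  descent : ∀ {m v} → IsWalk E m v → ∀ i → 1 ≤ i → suc i ≤ m →
    ¬ (col v i < col v (suc i)) → col v (suc i) < col v i
  descent w i 1≤i si≤m ¬up =
    ℕP.≤∧≢⇒< (ℕP.≮⇒≥ ¬up) (λ eq → consecutive-colours-differ w i 1≤i si≤m (sym eq))

  splice : (ℕ → Fin n) → (ℕ → Fin n) → ℕ → ℕ → Fin n
  splice A B a t with t ≤? a
  ... | yes _ = A t
  ... | no _ = B (t ∸ a)

  splice-left : ∀ A B a t → t ≤ a → splice A B a t ≡ A t
  splice-left A B a t t≤a with t ≤? a
  ... | yes _ = refl
  ... | no t≰a = ⊥-elim (t≰a t≤a)

  splice-right : ∀ A B a t → A a ≡ B 0 → splice A B a (a + t) ≡ B t
  splice-right A B a zero joint rewrite ℕP.+-identityʳ a = trans (splice-left A B a a ℕP.≤-refl) joint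
  splice-right A B a (suc t) joint with (a + suc t) ≤? a
  ... | yes p = ⊥-elim (ℕP.<-irrefl refl (ℕP.<-≤-trans (ℕP.m<m+n a (s≤s z≤n)) p))
  ... | no _ = cong B (ℕP.m+n∸m≡n a (suc t))

  splice-walk : ∀ A B a b → A a ≡ B 0 → IsWalk E a A → IsWalk E b B →
    (1 ≤ a → 1 ≤ b → A (a ∸ 1) ≢ B 1) → IsWalk E (a + b) (splice A B a)
  splice-walk A B a b joint (edgeA , noBackA) (edgeB , noBackB) noBackJunction = edge , noBack
    where
    Z : ℕ → Fin n
    Z = splice A B a
    edge : ∀ i → 1 ≤ i → i ≤ a + b → E (Z (i ∸ 1)) (Z i)
    edge i 1≤i i≤ab with ≤-or-beyond a i
    ... | inj₁ i≤a = subst₂ E (sym (splice-left A B a (i ∸ 1) (ℕP.≤-trans (ℕP.m∸n≤m i 1) i≤a)))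
                              (sym (splice-left A B a i i≤a)) (edgeA i 1≤i i≤a)
    ... | inj₂ (t , refl) = subst₂ E
      (sym (trans (cong Z (ℕP.+-∸-assoc a (s≤s (z≤n {t})))) (splice-right A B a t joint)))
      (sym (splice-right A B a (suc t) joint))
      (edgeB (suc t) (s≤s z≤n) (ℕP.+-cancelˡ-≤ a _ _ i≤ab))
    noBack : ∀ i → 2 ≤ i → i ≤ a + b → Z (i ∸ 2) ≢ Z i
    noBack i 2≤i i≤ab with ≤-or-beyond a i
    ... | inj₁ i≤a rewrite splice-left A B a (i ∸ 2) (ℕP.≤-trans (ℕP.m∸n≤m i 2) i≤a)
                         | splice-left A B a i i≤a = noBackA i 2≤i i≤a
    ... | inj₂ (zero , refl) rewrite splice-right A B a 1 joint = λ eq →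
      noBackJunction (ℕP.≤-pred (subst (2 ≤_) (ℕP.+-comm a 1) 2≤i)) (ℕP.+-cancelˡ-≤ a _ _ i≤ab)
        (trans (sym (splice-left A B a (a ∸ 1) (ℕP.m∸n≤m a 1))) (trans (cong Z (pred≡ a)) eq))
      where
      pred≡ : ∀ a → a ∸ 1 ≡ (a + 1) ∸ 2
      pred≡ zero = refl
      pred≡ (suc a) = sym (ℕP.m+n∸n≡m a 1)
    ... | inj₂ (suc t , refl) = subst₂ _≢_
      (sym (trans (cong Z (back2 a t)) (splice-right A B a t joint))) (sym (splice-right A B a (suc (suc t)) joint))
      (noBackB (suc (suc t)) (s≤s (s≤s z≤n)) (ℕP.+-cancelˡ-≤ a _ _ i≤ab))
      where
      back2 : ∀ a t → (a + suc (suc t)) ∸ 2 ≡ a + t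
      back2 a t rewrite ℕP.+-suc a (suc t) | ℕP.+-suc a t = refl

  splice-colour-left : ∀ A B a t → 1 ≤ t → t ≤ a → col (splice A B a) t ≡ col A t
  splice-colour-left A B a t 1≤t t≤a =
    cong₂ χ (splice-left A B a (t ∸ 1) (ℕP.≤-trans (ℕP.m∸n≤m t 1) t≤a)) (splice-left A B a t t≤a)

  splice-colour-right : ∀ A B a t → A a ≡ B 0 → col (splice A B a) (a + suc t) ≡ col B (suc t)
  splice-colour-right A B a t joint =
    cong₂ χ (trans (cong (splice A B a) (ℕP.+-∸-assoc a (s≤s (z≤n {t})))) (splice-right A B a t joint))
            (splice-right A B a (suc t) joint)

  shift : (ℕ → Fin n) → ℕ → ℕ → Fin n
  shift v q s = v (q + s)

  shift-walk : ∀ {m} v q r → q + r ≤ m → IsWalk E m v → IsWalk E r (shift v q)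
  shift-walk v q r q+r≤m (edge , noBack) = edge′ , noBack′
    where
    edge′ : ∀ i → 1 ≤ i → i ≤ r → E (shift v q (i ∸ 1)) (shift v q i)
    edge′ (suc i) _ i≤r = subst (λ x → E (v x) (v (q + suc i))) (ℕP.+-∸-assoc q (s≤s (z≤n {i})))
      (edge (q + suc i) (ℕP.≤-trans (s≤s z≤n) (ℕP.m≤n+m (suc i) q)) (ℕP.≤-trans (ℕP.+-monoʳ-≤ q i≤r) q+r≤m))
    noBack′ : ∀ i → 2 ≤ i → i ≤ r → shift v q (i ∸ 2) ≢ shift v q i
    noBack′ (suc zero) (s≤s ()) _
    noBack′ (suc (suc i)) _ i≤r = subst (λ x → v x ≢ v (q + suc (suc i))) (ℕP.+-∸-assoc q (s≤s (s≤s (z≤n {i}))))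
      (noBack (q + suc (suc i)) (ℕP.≤-trans (s≤s (s≤s z≤n)) (ℕP.m≤n+m (suc (suc i)) q)) (ℕP.≤-trans (ℕP.+-monoʳ-≤ q i≤r) q+r≤m))

  shift-colour : ∀ v q s → col (shift v q) (suc s) ≡ col v (q + suc s)
  shift-colour v q s = cong (λ x → χ (v x) (v (q + suc s))) (sym (ℕP.+-∸-assoc q (s≤s (z≤n {s}))))

  reverse : (ℕ → Fin n) → ℕ → ℕ → Fin n
  reverse v M t = v (M ∸ t)

  reverse-walk : ∀ {M} v L → L ≤ M → IsWalk E M v → IsWalk E L (reverse v M)
  reverse-walk {M} v L L≤M (edge , noBack) = edge′ , noBack′
    where
    edge′ : ∀ i → 1 ≤ i → i ≤ L → E (reverse v M (i ∸ 1)) (reverse v M i)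
    edge′ (suc i) _ i≤L = subst (λ x → E (v x) (v (M ∸ suc i))) (sym (∸-suc M i i<M))
        (E-sym _ _ (edge (suc (M ∸ suc i)) (s≤s z≤n) (subst (_≤ M) (∸-suc M i i<M) (ℕP.m∸n≤m M i))))
      where
      i<M : i < M
      i<M = ℕP.<-≤-trans (ℕP.n<1+n i) (ℕP.≤-trans i≤L L≤M)
    noBack′ : ∀ i → 2 ≤ i → i ≤ L → reverse v M (i ∸ 2) ≢ reverse v M i
    noBack′ (suc zero) (s≤s ()) _
    noBack′ (suc (suc i)) _ i≤L eq = noBack (suc (suc (M ∸ suc (suc i)))) (s≤s (s≤s z≤n)) inside
      (trans (sym eq) (cong v M∸i≡))
      where
      1+i<M : suc i < M
      1+i<M = ℕP.<-≤-trans (ℕP.n<1+n (suc i)) (ℕP.≤-trans i≤L L≤M)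
      M∸i≡ : M ∸ i ≡ suc (suc (M ∸ suc (suc i)))
      M∸i≡ = trans (∸-suc M i (ℕP.<-trans (ℕP.n<1+n i) 1+i<M)) (cong suc (∸-suc M (suc i) 1+i<M))
      inside : suc (suc (M ∸ suc (suc i))) ≤ M
      inside = subst (_≤ M) M∸i≡ (ℕP.m∸n≤m M i)

  reverse-colour : ∀ {M} v i → IsWalk E M v → 1 ≤ i → i ≤ M → col (reverse v M) i ≡ col v (suc (M ∸ i))
  reverse-colour {M} v (suc i) (edge , _) _ si≤M =
    trans (cong (λ x → χ (v x) (v (M ∸ suc i))) (∸-suc M i si≤M))
          (sym (χ-sym _ _ (edge (suc (M ∸ suc i)) (s≤s z≤n) (subst (_≤ M) (∸-suc M i si≤M) (ℕP.m∸n≤m M i)))))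

  shaved⊆ : ∀ j u v → shaveN χ j E u v → E u v
  shaved⊆ zero u v e = e
  shaved⊆ (suc j) u v (e , _ , _) = shaved⊆ j u v e

  shaved-sym : ∀ j u v → shaveN χ j E u v → shaveN χ j E v u
  shaved-sym zero = E-sym
  shaved-sym (suc j) u v (e , notMaxU , notMaxV) = shaved-sym j u v e , notMaxV , notMaxU

  walk-in-shaving : ∀ j {m v} → IsWalk (shaveN χ j E) m v → IsWalk E m v
  walk-in-shaving j (edge , noBack) = (λ i 1≤i i≤m → shaved⊆ j _ _ (edge i 1≤i i≤m)) , noBack

  larger-edge : ∀ r a b → shaveN χ (suc r) E a b → ¬ ¬ (Σ (Fin n) λ w → shaveN χ r E a w × χ a b < χ a w)
  larger-edge r a b (e , notMax , _) noLarger =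
    notMax (e , λ w aw → ℕP.≮⇒≥ (λ lt → noLarger (w , aw , lt)))

  record AscendingChain (a : Fin n) (bs : ℕ) (D : ℕ) : Set where
    field
      u : ℕ → Fin n
      u0 : u 0 ≡ a
      edge : ∀ i → i < D → E (u i) (u (suc i))
      first : 1 ≤ D → bs < χ (u 0) (u 1)
      incr : ∀ i → suc i < D → χ (u i) (u (suc i)) < χ (u (suc i)) (u (suc (suc i)))

  ascending-chain : ∀ r D → D ≤ r → ∀ a b → shaveN χ r E a b → ¬ ¬ AscendingChain a (χ a b) D
  ascending-chain r zero _ a b _ k =
    k record { u = λ _ → a ; u0 = refl ; edge = λ i () ; first = λ () ; incr = λ i () }
  ascending-chain (suc r) (suc D) (s≤s D≤r) a b ab k = larger-edge r a b ab λ { (w , aw , lt) →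
    ascending-chain r D D≤r w a (shaved-sym r a w aw) λ ch → k (prepend w aw lt ch) }
    where
    prepend : ∀ w → shaveN χ r E a w → χ a b < χ a w → AscendingChain w (χ w a) D → AscendingChain a (χ a b) (suc D)
    prepend w aw lt ch = record { u = U ; u0 = refl ; edge = edge′
                                ; first = λ _ → subst (λ x → χ a b < χ a x) (sym C.u0) lt ; incr = incr′ }
      where
      module C = AscendingChain ch
      U : ℕ → Fin n
      U zero = a
      U (suc i) = C.u i
      edge′ : ∀ i → i < suc D → E (U i) (U (suc i))
      edge′ zero _ = subst (E a) (sym C.u0) (shaved⊆ r a w aw)
      edge′ (suc i) (s≤s i<D) = C.edge i i<D
      incr′ : ∀ i → suc i < suc D → χ (U i) (U (suc i)) < χ (U (suc i)) (U (suc (suc i)))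
      incr′ zero (s≤s 1≤D) = subst (λ x → χ a x < χ x (C.u 1)) (sym C.u0)
        (subst (_< χ w (C.u 1)) (sym (χ-sym a w (shaved⊆ r a w aw)))
          (subst (λ x → χ w a < χ x (C.u 1)) C.u0 (C.first 1≤D)))
      incr′ (suc i) (s≤s si<D) = C.incr i si<D

  -- Increasing colours rule out backtracking, so a chain is a walk.
  chain-walk : ∀ {a bs D} (ch : AscendingChain a bs D) → IsWalk E D (AscendingChain.u ch)
  chain-walk {D = D} ch = edge′ , noBack
    where
    module C = AscendingChain ch
    edge′ : ∀ i → 1 ≤ i → i ≤ D → E (C.u (i ∸ 1)) (C.u i)
    edge′ (suc i) _ i≤D = C.edge i i≤D
    noBack : ∀ i → 2 ≤ i → i ≤ D → C.u (i ∸ 2) ≢ C.u i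
    noBack (suc zero) (s≤s ()) _
    noBack (suc (suc i)) _ i≤D eq = ℕP.<-irrefl sameColour (C.incr i i≤D)
      where
      sameColour : χ (C.u i) (C.u (suc i)) ≡ χ (C.u (suc i)) (C.u (suc (suc i)))
      sameColour = trans (χ-sym _ _ (C.edge i (ℕP.<-trans (ℕP.n<1+n i) i≤D))) (cong (χ (C.u (suc i))) eq)

module Obstructions {n : ℕ} (E : Rel n) (χ : Colouring n)
  (E-sym : ∀ u v → E u v → E v u)
  (χ-sym : ∀ u v → E u v → χ u v ≡ χ v u)
  (χ-proper : ∀ u v w → E u v → E u w → v ≢ w → χ u v ≢ χ u w)
  (K : ℕ)
  (no-fast : ∀ k′ → 2 ≤ k′ → k′ ≤ suc K → ¬ HasFastWalk E χ k′) where

  open Walks E χ E-sym χ-sym χ-proper public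

  S : Rel n
  S = shaveN χ K E

  -- Index q of a walk is a peak if c_q < c_{q+1} > c_{q+2}; the peak edge
  -- is v_q v_{q+1}, of colour c_{q+1}.
  IsPeak : (ℕ → Fin n) → ℕ → Set
  IsPeak v q = col v q < col v (suc q) × col v (suc (suc q)) < col v (suc q)

  peak? : ∀ v q → Dec (IsPeak v q)
  peak? v q = (col v q <? col v (suc q)) ×-dec (col v (suc (suc q)) <? col v (suc q))

  -- A walk in E that would violate k-flatness of S, in the weakened form
  -- which survives the surgery below: only its peak edges need to be in S.
  record Obstruction (m : ℕ) (v : ℕ → Fin n) : Set where
    field
      long : 2 ≤ m
      walk : IsWalk E m v
      negative : StaysNegative (col v) m
      ends-higher : col v 1 ≤ col v m
      rises : RisesAtMost K (col v) m
      peaks-shaved : ∀ q → 1 ≤ q → suc (suc q) ≤ m → IsPeak v q → S (v q) (v (suc q))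

  never-rising-ends-lower : ∀ m′ v → IsWalk E (suc m′) v → 1 ≤ m′ →
    (∀ i → i < m′ → ¬ (col v (suc i) < col v (suc (suc i)))) → col v (suc m′) < col v 1
  never-rising-ends-lower (suc m″) v w _ noRise = below-start m″ ℕP.≤-refl
    where
    below-start : ∀ t → suc t ≤ suc m″ → col v (suc (suc t)) < col v 1
    below-start zero h = descent w 1 (s≤s z≤n) (s≤s h) (noRise 0 h)
    below-start (suc t) h = ℕP.<-trans (descent w (suc (suc t)) (s≤s z≤n) (s≤s h) (noRise (suc t) h))
                                       (below-start t (ℕP.<⇒≤ h))

  keeps-rising : ∀ {m v} → IsWalk E m v → (∀ q → 1 ≤ q → suc (suc q) ≤ m → ¬ IsPeak v q) →
    ∀ i₀ → col v (suc i₀) < col v (suc (suc i₀)) →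
    ∀ t → i₀ ≤ t → suc (suc t) ≤ m → col v (suc t) < col v (suc (suc t))
  keeps-rising {m} {v} w noPeak i₀ rise₀ t i₀≤t t+2≤m with ℕP.m≤n⇒∃[o]m+o≡n i₀≤t
  ... | d , refl = rising d t+2≤m
    where
    c : ℕ → ℕ
    c = col v
    rising : ∀ d → suc (suc (i₀ + d)) ≤ m → c (suc (i₀ + d)) < c (suc (suc (i₀ + d)))
    rising zero _ rewrite ℕP.+-identityʳ i₀ = rise₀
    rising (suc d) h with c (suc (i₀ + suc d)) <? c (suc (suc (i₀ + suc d)))
    ... | yes up = up
    ... | no ¬up = ⊥-elim (noPeak (suc (i₀ + d)) (s≤s z≤n) h′ (rising d (ℕP.<⇒≤ h′) , fall))
      where
      h′ : suc (suc (suc (i₀ + d))) ≤ m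
      h′ = subst (λ x → suc (suc x) ≤ m) (ℕP.+-suc i₀ d) h
      fall : c (suc (suc (suc (i₀ + d)))) < c (suc (suc (i₀ + d)))
      fall = subst (λ x → c (suc (suc x)) < c (suc x)) (ℕP.+-suc i₀ d) (descent w (suc (i₀ + suc d)) (s≤s z≤n) h ¬up)

  -- A valley: a walk of length M = i₀ + b + 2 whose colours fall for i₀
  -- steps and then rise for b + 1 steps, ending no lower than it starts,
  -- with negative final height and rising at most K from its bottom.  Its
  -- last 2k′ edges, k′ = b + 2, read backwards form a k′-fast walk.
  module Valley (i₀ b : ℕ) (v : ℕ → Fin n)
    (walk : IsWalk E (suc (suc (i₀ + b))) v)
    (negative-end : height (col v) (suc (suc (i₀ + b))) <ℤ + 0)
    (ends-higher : col v 1 ≤ col v (suc (suc (i₀ + b))))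
    (rise-from-bottom : height (col v) (suc (suc (i₀ + b))) ≤ℤ height (col v) (suc i₀) +ℤ + K)
    (no-rise-before : ∀ j → j < i₀ → ¬ (col v (suc j) < col v (suc (suc j))))
    (rise-after : ∀ t → i₀ ≤ t → t < suc (i₀ + b) → col v (suc t) < col v (suc (suc t))) where

    c : ℕ → ℕ
    c = col v

    M : ℕ
    M = suc (suc (i₀ + b))

    falls : ∀ j → j < i₀ → c (suc (suc j)) < c (suc j)
    falls j j<i₀ = descent walk (suc j) (s≤s z≤n) (s≤s (s≤s (ℕP.≤-trans (ℕP.<⇒≤ j<i₀) (ℕP.m≤m+n i₀ b))))
                     (no-rise-before j j<i₀)

    below-start : ∀ t → t ≤ i₀ → c (suc t) ≤ c 1
    below-start zero _ = ℕP.≤-refl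
    below-start (suc t) h = ℕP.≤-trans (ℕP.<⇒≤ (falls t h)) (below-start t (ℕP.<⇒≤ h))

    M≡ : M ≡ suc i₀ + suc b
    M≡ = cong suc (sym (ℕP.+-suc i₀ b))

    height-bottom : height c (suc i₀) ≡ - (+ i₀)
    height-bottom = trans (height-gain c 0 i₀) (trans (ℤP.+-identityˡ _) (gain-descending c 1 i₀ no-rise-before))

    height-end : height c M ≡ - (+ i₀) +ℤ + suc b
    height-end = begin
      height c M                                  ≡⟨ cong (height c) M≡ ⟩
      height c (suc i₀ + suc b)                   ≡⟨ height-gain c i₀ (suc b) ⟩
      height c (suc i₀) +ℤ gain c (suc i₀) (suc b) ≡⟨ cong₂ _+ℤ_ height-bottom (gain-ascending c (suc i₀) (suc b) ascent) ⟩
      - (+ i₀) +ℤ + suc b                         ∎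
      where
      open ≡-Reasoning
      ascent : ∀ j → j < suc b → c (suc i₀ + j) < c (suc (suc i₀ + j))
      ascent j j<1+b = rise-after (i₀ + j) (ℕP.m≤m+n i₀ j) (s≤s (ℕP.+-monoʳ-≤ i₀ (ℕP.≤-pred j<1+b)))

    -- The ascent is shorter than the descent (the final height is
    -- negative) and has length at most K (the rise bound).
    ascent<descent : suc b < i₀
    ascent<descent = -+<0⇒< i₀ (suc b) (subst (_<ℤ + 0) height-end negative-end)

    ascent≤K : suc b ≤ K
    ascent≤K = ℤ.drop‿+≤+ (+-cancelˡ-≤ℤ (- (+ i₀))
      (subst₂ _≤ℤ_ height-end (cong (_+ℤ + K) height-bottom) rise-from-bottom))

    k′ : ℕ
    k′ = suc (suc b)

    F : ℕ → Fin n
    F = reverse v M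

    2k′≤M : 2 * k′ ≤ M
    2k′≤M = subst (_≤ M) (cong (λ x → k′ + x) (sym (ℕP.+-identityʳ k′)))
              (subst (k′ + k′ ≤_) (trans (ℕP.+-suc i₀ (suc b)) (cong suc (ℕP.+-suc i₀ b)))
                (ℕP.+-monoˡ-≤ k′ ascent<descent))

    M≤i₀+ : ∀ j → k′ ≤ j → M ≤ i₀ + j
    M≤i₀+ j k′≤j = subst (_≤ i₀ + j) (trans (ℕP.+-suc i₀ (suc b)) (cong suc (ℕP.+-suc i₀ b)))
                     (ℕP.+-monoʳ-≤ i₀ k′≤j)

    colour-F : ∀ j → 1 ≤ j → j ≤ M → col F j ≡ c (suc (M ∸ j))
    colour-F j 1≤j j≤M = reverse-colour v j walk 1≤j j≤M

    -- Backwards, the ascent becomes the falling first half …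
    first-half-falls : ∀ j → 1 ≤ j → j < k′ → col F (suc j) < col F j
    first-half-falls j 1≤j j<k′ = subst₂ _<_ (sym (colour-F (suc j) (s≤s z≤n) 1+j≤M))
      (sym (trans (colour-F j 1≤j (ℕP.<⇒≤ 1+j≤M)) (cong (λ x → c (suc x)) (∸-suc M j 1+j≤M))))
      (rise-after (M ∸ suc j)
        (+∸-≤ i₀ j (suc (i₀ + b)) (subst (i₀ + j ≤_) (ℕP.+-suc i₀ b) (ℕP.+-monoʳ-≤ i₀ (ℕP.≤-pred j<k′))))
        (∸-<-self (suc (i₀ + b)) j 1≤j (ℕP.≤-trans (ℕP.≤-pred j<k′) (s≤s (ℕP.m≤n+m b i₀)))))
      where
      1+j≤M : suc j ≤ M
      1+j≤M = ℕP.≤-trans j<k′ (ℕP.≤-trans (ℕP.m≤m+n k′ (k′ + 0)) 2k′≤M)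

    -- … and the end of the descent the rising second half.
    second-half-rises : ∀ j → k′ ≤ j → j < 2 * k′ → col F j < col F (suc j)
    second-half-rises j k′≤j j<2k′ = subst₂ _<_
      (sym (trans (colour-F j (ℕP.≤-trans (s≤s z≤n) k′≤j) (ℕP.<⇒≤ j<M)) (cong (λ x → c (suc x)) (∸-suc M j j<M))))
      (sym (colour-F (suc j) (s≤s z≤n) j<M))
      (falls (M ∸ suc j) (subst (_≤ i₀) (∸-suc M j j<M) (∸-≤+ M j i₀ (M≤i₀+ j k′≤j))))
      where
      j<M : j < M
      j<M = ℕP.<-≤-trans j<2k′ 2k′≤M

    ends-no-higher : col F (2 * k′) ≤ col F 1
    ends-no-higher = subst₂ _≤_
      (sym (colour-F (2 * k′) (ℕP.≤-trans (s≤s z≤n) (ℕP.m≤m+n k′ (k′ + 0))) 2k′≤M))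
      (sym (colour-F 1 (s≤s z≤n) (s≤s z≤n)))
      (ℕP.≤-trans (below-start (M ∸ (2 * k′))
        (∸-≤+ M (2 * k′) i₀ (ℕP.≤-trans (M≤i₀+ k′ ℕP.≤-refl) (ℕP.+-monoʳ-≤ i₀ (ℕP.m≤m+n k′ (k′ + 0))))))
        ends-higher)

    fast-walk : HasFastWalk E χ k′
    fast-walk = F , reverse-walk v (2 * k′) 2k′≤M walk , first-half-falls , second-half-rises , ends-no-higher

  valley-lemma : ∀ m′ v → 1 ≤ m′ → IsWalk E (suc m′) v → height (col v) (suc m′) <ℤ + 0 →
    col v 1 ≤ col v (suc m′) →
    (∀ j → 1 ≤ j → j ≤ suc m′ → height (col v) (suc m′) ≤ℤ height (col v) j +ℤ + K) →
    (∀ q → 1 ≤ q → suc (suc q) ≤ suc m′ → ¬ IsPeak v q) → ⊥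
  valley-lemma m′ v 1≤m′ w negative-end ends-higher rise-to-end noPeak
    with least (λ i → col v (suc i) < col v (suc (suc i))) (λ i → col v (suc i) <? col v (suc (suc i))) m′
  ... | inj₁ noRise = ℕP.<-irrefl refl (ℕP.<-≤-trans (never-rising-ends-lower m′ v w 1≤m′ noRise) ends-higher)
  ... | inj₂ (i₀ , i₀<m′ , rise₀ , noRiseBefore) with ℕP.m≤n⇒∃[o]m+o≡n i₀<m′
  ... | b , refl = no-fast (suc (suc b)) (s≤s (s≤s z≤n)) (s≤s V.ascent≤K) V.fast-walk
    where
    module V = Valley i₀ b v w negative-end ends-higher
      (rise-to-end (suc i₀) (s≤s z≤n) (ℕP.≤-trans (ℕP.n≤1+n (suc i₀)) (s≤s (s≤s (ℕP.m≤m+n i₀ b)))))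
      noRiseBefore
      (λ t i₀≤t t<1+i₀+b → keeps-rising w noPeak i₀ rise₀ t i₀≤t (s≤s t<1+i₀+b))

  -- The reduction at the last peak q of an obstruction of length
  -- m = q + r + 2.  Its peak edge lies in S, hence starts an ascending
  -- chain of any length D ≤ K.  A good length D is chosen from the heights;
  -- then either splicing the chain after v_q gives a shorter obstruction,
  -- or the reversed chain followed by the tail of the walk is a valley.
  module LastPeak (i r : ℕ) (v : ℕ → Fin n)
    (ob : Obstruction (suc (suc (suc (i + r)))) v)
    (peak : IsPeak v (suc i))
    (last-peak : ∀ j → i < j → j < suc (i + r) → ¬ IsPeak v (suc j))
    (shorter : ∀ {m′} v′ → m′ < suc (suc (suc (i + r))) → Obstruction m′ v′ → ⊥) where

    open Obstruction ob

    c : ℕ → ℕ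
    c = col v

    q m : ℕ
    q = suc i
    m = suc (suc (suc (i + r)))

    hq hm : ℤ
    hq = height c q
    hm = height c m

    q+1≤m : suc q ≤ m
    q+1≤m = ℕP.≤-trans (ℕP.n≤1+n (suc q)) (s≤s (s≤s (s≤s (ℕP.m≤m+n i r))))

    q≤m : q ≤ m
    q≤m = ℕP.≤-trans (ℕP.n≤1+n q) q+1≤m

    peak-edge-shaved : S (v q) (v (suc q))
    peak-edge-shaved = peaks-shaved q (s≤s z≤n) (s≤s (s≤s (s≤s (ℕP.m≤m+n i r)))) peak

    height-at-peak : height c (suc q) ≡ hq +ℤ + 1
    height-at-peak = trans (height-step c i) (cong (hq +ℤ_) (slope-up (proj₁ peak)))

    height-after-peak : height c (suc (suc q)) ≡ hq
    height-after-peak = begin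
      height c (suc (suc q))                    ≡⟨ height-step c q ⟩
      height c (suc q) +ℤ slope (c (suc q)) (c (suc (suc q)))
                                                ≡⟨ cong₂ _+ℤ_ height-at-peak (slope-down (ℕP.<-asym (proj₂ peak))) ⟩
      (hq +ℤ + 1) +ℤ -[1+ 0 ]                   ≡⟨ ℤP.+-assoc hq (+ 1) -[1+ 0 ] ⟩
      hq +ℤ + 0                                 ≡⟨ ℤP.+-identityʳ hq ⟩
      hq                                        ∎
      where open ≡-Reasoning

    record GoodLength (D′ : ℕ) : Set where
      field
        stays-negative : hq +ℤ + suc D′ <ℤ + 0
        reaches-end : hm ≤ℤ hq +ℤ + suc D′
        within-rise : ∀ a → 1 ≤ a → a ≤ q → hq +ℤ + suc D′ ≤ℤ height c a +ℤ + K
        shortens : q + suc D′ < m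

    good-length≤K : ∀ {D′} → GoodLength D′ → suc D′ ≤ K
    good-length≤K good = ℤ.drop‿+≤+ (+-cancelˡ-≤ℤ hq (GoodLength.within-rise good q (s≤s z≤n) ℕP.≤-refl))

    length-one : hm ≤ℤ height c (suc q) → GoodLength 0
    length-one hm≤ = record
      { stays-negative = subst (_<ℤ + 0) height-at-peak (negative (suc q) (s≤s (s≤s z≤n)) q+1≤m)
      ; reaches-end = subst (hm ≤ℤ_) height-at-peak hm≤
      ; within-rise = λ a 1≤a a≤q → subst (_≤ℤ height c a +ℤ + K) height-at-peak
                        (rises a (suc q) 1≤a (ℕP.≤-trans a≤q (ℕP.n≤1+n q)) q+1≤m)
      ; shortens = subst (_< m) (ℕP.+-comm 1 q) (s≤s (s≤s (s≤s (ℕP.m≤m+n i r)))) }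

    length-to-end : ∀ D′ → hm ≡ hq +ℤ + suc D′ → GoodLength D′
    length-to-end D′ hm≡ = record
      { stays-negative = subst (_<ℤ + 0) hm≡ (negative m long ℕP.≤-refl)
      ; reaches-end = ℤP.≤-reflexive hm≡
      ; within-rise = λ a 1≤a a≤q → subst (_≤ℤ height c a +ℤ + K) hm≡ (rises a m 1≤a (ℕP.≤-trans a≤q q≤m) ℕP.≤-refl)
      ; shortens = ℕP.≤-<-trans (ℕP.+-monoʳ-≤ q D≤r) (s≤s (s≤s (ℕP.n≤1+n (i + r)))) }
      where
      hm≡tail : hm ≡ hq +ℤ gain c (suc (suc q)) r
      hm≡tail = trans (height-gain c (suc (suc i)) r) (cong (_+ℤ gain c (suc (suc q)) r) height-after-peak)
      D≤r : suc D′ ≤ r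
      D≤r = ℤ.drop‿+≤+ (+-cancelˡ-≤ℤ hq (subst (_≤ℤ hq +ℤ + r) (trans (sym hm≡tail) hm≡)
              (ℤP.+-monoʳ-≤ hq (gain≤length c (suc (suc q)) r))))

    hq≤hm : ¬ (hm ≤ℤ height c (suc q)) → hq ≤ℤ hm
    hq≤hm hm≰ = ℤP.≤-trans (subst (hq ≤ℤ_) (sym height-at-peak) (ℤP.i≤i+j hq (+ 1))) (ℤP.<⇒≤ (ℤP.≰⇒> hm≰))

    good-length : Σ ℕ GoodLength
    good-length with hm ℤP.≤? height c (suc q)
    ... | yes hm≤ = 0 , length-one hm≤
    ... | no hm≰ with ≤⇒difference hq hm (hq≤hm hm≰)
    ...   | suc D′ , hm≡ = D′ , length-to-end D′ hm≡
    ...   | zero , hm≡ = ⊥-elim (ℕP.<-irrefl refl (ℤ.drop‿+≤+ (+-cancelˡ-≤ℤ hq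
                           (ℤP.<⇒≤ (subst₂ _<ℤ_ height-at-peak hm≡ (ℤP.≰⇒> hm≰))))))

    module WithChain (D′ : ℕ) (good : GoodLength D′)
      (chain : AscendingChain (v q) (χ (v q) (v (suc q))) (suc D′)) where

      open GoodLength good

      D : ℕ
      D = suc D′

      u : ℕ → Fin n
      u = AscendingChain.u chain

      cu : ℕ → ℕ
      cu = col u

      D≤K : D ≤ K
      D≤K = good-length≤K good

      chain-is-walk : IsWalk E D u
      chain-is-walk = chain-walk chain

      starts-at-peak : u 0 ≡ v q
      starts-at-peak = AscendingChain.u0 chain

      above-peak : c (suc q) < cu 1
      above-peak = AscendingChain.first chain (s≤s z≤n)

      -- First case: the walk X = v₀ … v_q u₁ … u_D.

      X : ℕ → Fin n
      X = splice v u q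

      cX : ℕ → ℕ
      cX = col X

      no-backtrack-at-q : 1 ≤ q → 1 ≤ D → v (q ∸ 1) ≢ u 1
      no-backtrack-at-q _ _ eq = ℕP.<-irrefl (sym same) (ℕP.<-trans (proj₁ peak) above-peak)
        where
        same : cu 1 ≡ c q
        same = trans (cong (λ x → χ x (u 1)) starts-at-peak)
                 (trans (cong (χ (v q)) (sym eq)) (sym (χ-sym (v i) (v q) (proj₁ walk q (s≤s z≤n) q≤m))))

      spliced-walk : IsWalk E (q + D) X
      spliced-walk = splice-walk v u q D (sym starts-at-peak) (walk-prefix q≤m walk) chain-is-walk no-backtrack-at-q

      colour-X-left : ∀ t → 1 ≤ t → t ≤ q → cX t ≡ c t
      colour-X-left = splice-colour-left v u q

      colour-X-right : ∀ t → cX (q + suc t) ≡ cu (suc t)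
      colour-X-right t = splice-colour-right v u q t (sym starts-at-peak)

      X-ascends : ∀ t → t < D → cX (q + t) < cX (suc (q + t))
      X-ascends zero _ = subst₂ _<_
        (sym (trans (cong cX (ℕP.+-identityʳ q)) (colour-X-left q (s≤s z≤n) ℕP.≤-refl)))
        (sym (trans (cong cX (sym (ℕP.+-suc q 0))) (colour-X-right 0)))
        (ℕP.<-trans (proj₁ peak) above-peak)
      X-ascends (suc t) t+1<D = subst₂ _<_ (sym (colour-X-right t))
        (sym (trans (cong cX (sym (ℕP.+-suc q (suc t)))) (colour-X-right (suc t))))
        (AscendingChain.incr chain t t+1<D)

      height-X-left : ∀ j → 1 ≤ j → j ≤ q → height cX j ≡ height c j
      height-X-left = height-cong cX c q colour-X-left

      height-X-right : ∀ t → t ≤ D → height cX (q + t) ≡ hq +ℤ + t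
      height-X-right t t≤D = trans (height-gain cX i t)
        (cong₂ _+ℤ_ (height-X-left q (s≤s z≤n) ℕP.≤-refl)
                    (gain-ascending cX q t (λ j j<t → X-ascends j (ℕP.<-≤-trans j<t t≤D))))

      X-negative : StaysNegative cX (q + D)
      X-negative j 2≤j j≤q+D with ≤-or-beyond q j
      ... | inj₁ j≤q = subst (_<ℤ + 0) (sym (height-X-left j (ℕP.≤-trans (s≤s z≤n) 2≤j) j≤q))
                         (negative j 2≤j (ℕP.≤-trans j≤q q≤m))
      ... | inj₂ (t , refl) = subst (_<ℤ + 0) (sym (height-X-right (suc t) t<D))
                                (ℤP.≤-<-trans (ℤP.+-monoʳ-≤ hq (ℤ.+≤+ t<D)) stays-negative)
        where
        t<D : suc t ≤ D
        t<D = ℕP.+-cancelˡ-≤ q _ _ j≤q+D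

      -- A rise ending on the chain is bounded by within-rise when it starts
      -- in the prefix, and by the chain length D ≤ K otherwise.
      X-rises-into-chain : ∀ t → suc t ≤ D → ∀ a → 1 ≤ a → a ≤ q + suc t →
        height cX (q + suc t) ≤ℤ height cX a +ℤ + K
      X-rises-into-chain t t<D a 1≤a a≤b with ≤-or-beyond q a
      ... | inj₁ a≤q = subst₂ (λ x y → x ≤ℤ y +ℤ + K) (sym (height-X-right (suc t) t<D)) (sym (height-X-left a 1≤a a≤q))
                         (ℤP.≤-trans (ℤP.+-monoʳ-≤ hq (ℤ.+≤+ t<D)) (within-rise a 1≤a a≤q))
      ... | inj₂ (t′ , refl) = subst₂ (λ x y → x ≤ℤ y +ℤ + K) (sym (height-X-right (suc t) t<D))
          (sym (height-X-right (suc t′) (ℕP.≤-trans (ℕP.+-cancelˡ-≤ q _ _ a≤b) t<D)))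
          (subst (hq +ℤ + suc t ≤ℤ_) (sym (ℤP.+-assoc hq (+ suc t′) (+ K)))
            (ℤP.+-monoʳ-≤ hq (subst (+ suc t ≤ℤ_) (ℤP.pos-+ (suc t′) K)
              (ℤ.+≤+ (ℕP.≤-trans (ℕP.≤-trans t<D D≤K) (ℕP.m≤n+m K (suc t′)))))))

      X-rises : RisesAtMost K cX (q + D)
      X-rises a b 1≤a a≤b b≤q+D with ≤-or-beyond q b
      ... | inj₁ b≤q = subst₂ (λ x y → x ≤ℤ y +ℤ + K) (sym (height-X-left b (ℕP.≤-trans 1≤a a≤b) b≤q))
                         (sym (height-X-left a 1≤a (ℕP.≤-trans a≤b b≤q))) (rises a b 1≤a a≤b (ℕP.≤-trans b≤q q≤m))
      ... | inj₂ (t , refl) = X-rises-into-chain t (ℕP.+-cancelˡ-≤ q _ _ b≤q+D) a 1≤a a≤b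

      -- Peaks of X lie in the prefix (the chain ascends), where they are
      -- peaks of the original walk.
      X-peaks-shaved : ∀ q′ → 1 ≤ q′ → suc (suc q′) ≤ q + D → IsPeak X q′ → S (X q′) (X (suc q′))
      X-peaks-shaved q′ 1≤q′ q′+2≤q+D (up , down) = by-position (suc (suc q′) ≤? q)
        where
        by-position : Dec (suc (suc q′) ≤ q) → S (X q′) (X (suc q′))
        by-position (yes q′+2≤q) = subst₂ S (sym (splice-left v u q q′ q′≤q)) (sym (splice-left v u q (suc q′) q′+1≤q))
          (peaks-shaved q′ 1≤q′ (ℕP.≤-trans q′+2≤q q≤m)
            ( subst₂ _<_ (colour-X-left q′ 1≤q′ q′≤q) (colour-X-left (suc q′) (s≤s z≤n) q′+1≤q) up
            , subst₂ _<_ (colour-X-left (suc (suc q′)) (s≤s z≤n) q′+2≤q) (colour-X-left (suc q′) (s≤s z≤n) q′+1≤q) down))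
          where
          q′+1≤q : suc q′ ≤ q
          q′+1≤q = ℕP.≤-trans (ℕP.n≤1+n (suc q′)) q′+2≤q
          q′≤q : q′ ≤ q
          q′≤q = ℕP.≤-trans (ℕP.n≤1+n q′) q′+1≤q
        by-position (no q′+2≰q) = ⊥-elim (ℕP.<-asym down (subst (λ x → cX x < cX (suc x)) q+t≡ (X-ascends t t<D)))
          where
          q≤q′+1 : q ≤ suc q′
          q≤q′+1 = ℕP.≤-pred (ℕP.≰⇒> q′+2≰q)
          t : ℕ
          t = proj₁ (ℕP.m≤n⇒∃[o]m+o≡n q≤q′+1)
          q+t≡ : q + t ≡ suc q′
          q+t≡ = proj₂ (ℕP.m≤n⇒∃[o]m+o≡n q≤q′+1)
          t<D : t < D
          t<D = ℕP.+-cancelˡ-≤ q _ _ (subst (_≤ q + D) (sym (ℕP.+-suc q t))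
                  (subst (λ x → suc x ≤ q + D) (sym q+t≡) q′+2≤q+D))

      spliced-obstruction : c 1 ≤ cu D → Obstruction (q + D) X
      spliced-obstruction c₁≤ = record
        { long = s≤s (ℕP.≤-trans (s≤s z≤n) (ℕP.m≤n+m D i))
        ; walk = spliced-walk
        ; negative = X-negative
        ; ends-higher = subst₂ _≤_ (sym (colour-X-left 1 (s≤s z≤n) (s≤s z≤n))) (sym (colour-X-right D′)) c₁≤
        ; rises = X-rises
        ; peaks-shaved = X-peaks-shaved }

      -- Second case: the walk Y = u_D … u₁ v_q v_{q+1} … v_m of length
      -- D + r + 2, which descends along the reversed chain into the peak
      -- edge and then follows the peak-free tail of the walk.

      Y : ℕ → Fin n
      Y = splice (reverse u D) (shift v q) D

      cY : ℕ → ℕ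
      cY = col Y

      m′Y : ℕ
      m′Y = D + suc r

      q+r+2≡m : q + suc (suc r) ≡ m
      q+r+2≡m = trans (ℕP.+-suc q (suc r)) (cong suc (ℕP.+-suc q r))

      q+1+r+1≡m : suc q + suc r ≡ m
      q+1+r+1≡m = cong suc (ℕP.+-suc q r)

      reverse-joins : reverse u D D ≡ shift v q 0
      reverse-joins = trans (cong u (ℕP.n∸n≡0 D)) (trans starts-at-peak (cong v (sym (ℕP.+-identityʳ q))))

      no-backtrack-at-v_q : 1 ≤ D → 1 ≤ suc (suc r) → reverse u D (D ∸ 1) ≢ shift v q 1
      no-backtrack-at-v_q _ _ eq = ℕP.<-irrefl (sym same) above-peak
        where
        D∸[D∸1]≡1 : D ∸ (D ∸ 1) ≡ 1
        D∸[D∸1]≡1 = ℕP.m+n∸n≡m 1 D′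
        same : cu 1 ≡ c (suc q)
        same = trans (cong (λ x → χ x (u 1)) starts-at-peak)
                 (cong (χ (v q)) (trans (sym (cong u D∸[D∸1]≡1)) (trans eq (cong v (ℕP.+-comm q 1)))))

      reversed-walk : IsWalk E (suc m′Y) Y
      reversed-walk = subst (λ x → IsWalk E x Y) (ℕP.+-suc D (suc r))
        (splice-walk (reverse u D) (shift v q) D (suc (suc r)) reverse-joins
          (reverse-walk u D ℕP.≤-refl chain-is-walk)
          (shift-walk v q (suc (suc r)) (ℕP.≤-reflexive q+r+2≡m) walk)
          no-backtrack-at-v_q)

      colour-Y-left : ∀ t → 1 ≤ t → t ≤ D → cY t ≡ cu (suc (D ∸ t))
      colour-Y-left t 1≤t t≤D = trans (splice-colour-left (reverse u D) (shift v q) D t 1≤t t≤D)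
                                      (reverse-colour u t chain-is-walk 1≤t t≤D)

      colour-Y-right : ∀ s → cY (D + suc s) ≡ c (q + suc s)
      colour-Y-right s = trans (splice-colour-right (reverse u D) (shift v q) D s reverse-joins) (shift-colour v q s)

      colour-Y-tail : ∀ j → cY (suc D + j) ≡ c (suc q + j)
      colour-Y-tail j = trans (cong cY (sym (ℕP.+-suc D j))) (trans (colour-Y-right j) (cong c (ℕP.+-suc q j)))

      -- The reversed chain descends, and keeps descending into the peak
      -- edge, whose colour lies below that of the first chain edge.
      Y-falls : ∀ j → j < D → cY (suc (suc j)) < cY (suc j)
      Y-falls j j<D with ℕP.m≤n⇒m<n∨m≡n j<D
      ... | inj₁ j+1<D = subst₂ _<_ (sym (colour-Y-left (suc (suc j)) (s≤s z≤n) j+1<D))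
          (sym (trans (colour-Y-left (suc j) (s≤s z≤n) j<D) (cong (λ x → cu (suc x)) (∸-suc D (suc j) j+1<D))))
          (AscendingChain.incr chain (D ∸ suc (suc j)) inside)
        where
        inside : suc (D ∸ suc (suc j)) < D
        inside = subst (_< D) (∸-suc D (suc j) j+1<D) (∸-<-self D (suc j) (s≤s z≤n) j<D)
      ... | inj₂ j+1≡D = subst₂ _<_ (sym at-peak) (sym at-chain-start) above-peak
        where
        at-peak : cY (suc (suc j)) ≡ c (suc q)
        at-peak = trans (cong cY (trans (cong suc j+1≡D) (sym (ℕP.+-comm D 1))))
                    (trans (colour-Y-right 0) (cong c (ℕP.+-comm q 1)))
        at-chain-start : cY (suc j) ≡ cu 1
        at-chain-start = trans (colour-Y-left (suc j) (s≤s z≤n) (ℕP.≤-reflexive j+1≡D))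
                           (cong (λ x → cu (suc x)) (trans (cong (D ∸_) j+1≡D) (ℕP.n∸n≡0 D)))

      height-Y-descent : ∀ t → t ≤ D → height cY (suc t) ≡ - (+ t)
      height-Y-descent t t≤D = trans (height-gain cY 0 t) (trans (ℤP.+-identityˡ _)
        (gain-descending cY 1 t (λ j j<t → ℕP.<-asym (Y-falls j (ℕP.<-≤-trans j<t t≤D)))))

      tail-gain : ℕ → ℤ
      tail-gain s = gain c (suc q) s

      height-Y-tail : ∀ s → height cY (suc D + s) ≡ - (+ D) +ℤ tail-gain s
      height-Y-tail s = trans (height-gain cY D s)
        (cong₂ _+ℤ_ (height-Y-descent D ℕP.≤-refl) (gain-cong cY c (suc D) (suc q) s (λ j _ → colour-Y-tail j)))

      height-tail : ∀ s → height c (suc q + s) ≡ (hq +ℤ + 1) +ℤ tail-gain s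
      height-tail s = trans (height-gain c q s) (cong (_+ℤ tail-gain s) height-at-peak)

      hm≡ : hm ≡ (hq +ℤ + 1) +ℤ tail-gain (suc r)
      hm≡ = trans (cong (height c) (sym q+1+r+1≡m)) (height-tail (suc r))

      hm≡hq+ : hm ≡ hq +ℤ (+ 1 +ℤ tail-gain (suc r))
      hm≡hq+ = trans hm≡ (ℤP.+-assoc hq (+ 1) (tail-gain (suc r)))

      Y-negative-end : height cY (suc m′Y) <ℤ + 0
      Y-negative-end = subst (_<ℤ + 0) (sym (height-Y-tail (suc r)))
        (subst (- (+ D) +ℤ tail-gain (suc r) <ℤ_) (ℤP.+-inverseˡ (+ D))
          (ℤP.+-monoʳ-< (- (+ D)) (ℤP.suc[i]≤j⇒i<j {tail-gain (suc r)} {+ D} 1+tail-gain≤D)))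
        where
        1+tail-gain≤D : + 1 +ℤ tail-gain (suc r) ≤ℤ + D
        1+tail-gain≤D = +-cancelˡ-≤ℤ hq (subst (_≤ℤ hq +ℤ + D) hm≡hq+ reaches-end)

      Y-ends-higher : cu D < c 1 → cY 1 ≤ cY (suc m′Y)
      Y-ends-higher cuD<c₁ = subst₂ _≤_ (sym (colour-Y-left 1 (s≤s z≤n) (s≤s z≤n)))
        (sym (trans (cong cY (sym (ℕP.+-suc D (suc r)))) (trans (colour-Y-right (suc r)) (cong c q+r+2≡m))))
        (ℕP.<⇒≤ (ℕP.<-≤-trans cuD<c₁ ends-higher))

      -- The final height of Y is at most K above each earlier one: over the
      -- reversed chain it only descends, and over the tail this is the rise
      -- bound of the original walk.
      Y-rise-to-end : ∀ j → 1 ≤ j → j ≤ suc m′Y → height cY (suc m′Y) ≤ℤ height cY j +ℤ + K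
      Y-rise-to-end (suc t) _ t+1≤ with ≤-or-beyond D (suc t)
      ... | inj₁ t+1≤D = subst₂ (λ x y → x ≤ℤ y +ℤ + K) (sym (height-Y-tail (suc r))) (sym (height-Y-descent t (ℕP.<⇒≤ t+1≤D)))
          (ℤP.+-mono-≤ (ℤP.neg-mono-≤ (ℤ.+≤+ (ℕP.<⇒≤ t+1≤D))) tail-gain≤K)
        where
        tail-gain≤K : tail-gain (suc r) ≤ℤ + K
        tail-gain≤K = ℤP.≤-trans (ℤP.i≤suc[i] _) (+-cancelˡ-≤ℤ hq
          (subst (_≤ℤ hq +ℤ + K) hm≡hq+ (rises q m (s≤s z≤n) q≤m ℕP.≤-refl)))
      ... | inj₂ (s , t+1≡) = subst₂ (λ x y → x ≤ℤ y +ℤ + K) (sym (height-Y-tail (suc r)))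
          (sym (trans (cong (height cY) (trans t+1≡ (ℕP.+-suc D s))) (height-Y-tail s)))
          (subst (- (+ D) +ℤ tail-gain (suc r) ≤ℤ_) (sym (ℤP.+-assoc (- (+ D)) (tail-gain s) (+ K)))
            (ℤP.+-monoʳ-≤ (- (+ D)) tail-rise))
        where
        s≤r+1 : s ≤ suc r
        s≤r+1 = ℕP.≤-pred (ℕP.+-cancelˡ-≤ D _ _ (subst₂ _≤_ t+1≡ (sym (ℕP.+-suc D (suc r))) t+1≤))
        rise : hm ≤ℤ height c (suc q + s) +ℤ + K
        rise = rises (suc q + s) m (s≤s z≤n) (ℕP.≤-trans (ℕP.+-monoʳ-≤ (suc q) s≤r+1) (ℕP.≤-reflexive q+1+r+1≡m)) ℕP.≤-refl
        tail-rise : tail-gain (suc r) ≤ℤ tail-gain s +ℤ + K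
        tail-rise = +-cancelˡ-≤ℤ (hq +ℤ + 1) (subst₂ _≤ℤ_ hm≡
          (trans (cong (_+ℤ + K) (height-tail s)) (ℤP.+-assoc (hq +ℤ + 1) (tail-gain s) (+ K))) rise)

      -- Y has no peak: the reversed chain descends, and a peak in the tail
      -- would be a peak of the walk after its last peak.
      Y-no-peak : ∀ q′ → 1 ≤ q′ → suc (suc q′) ≤ suc m′Y → ¬ IsPeak Y q′
      Y-no-peak (suc j) _ j+3≤ (up , down) with ≤-or-beyond D (suc j)
      ... | inj₁ j+1≤D = ℕP.<-asym up (Y-falls j j+1≤D)
      ... | inj₂ (s , j+1≡) = last-peak (q + s) (s≤s (ℕP.m≤m+n i s)) (s≤s (ℕP.+-monoʳ-< i s<r)) (peak-up , peak-down)
        where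
        j+1≡′ : suc j ≡ suc D + s
        j+1≡′ = trans j+1≡ (ℕP.+-suc D s)
        j+2≡ : suc (suc j) ≡ suc D + suc s
        j+2≡ = trans (cong suc j+1≡′) (sym (ℕP.+-suc (suc D) s))
        j+3≡ : suc (suc (suc j)) ≡ suc D + suc (suc s)
        j+3≡ = trans (cong suc j+2≡) (sym (ℕP.+-suc (suc D) (suc s)))
        colour₀ : cY (suc j) ≡ c (suc (q + s))
        colour₀ = trans (cong cY j+1≡′) (colour-Y-tail s)
        colour₁ : cY (suc (suc j)) ≡ c (suc (suc (q + s)))
        colour₁ = trans (cong cY j+2≡) (trans (colour-Y-tail (suc s)) (cong c (cong suc (ℕP.+-suc q s))))
        colour₂ : cY (suc (suc (suc j))) ≡ c (suc (suc (suc (q + s))))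
        colour₂ = trans (cong cY j+3≡) (trans (colour-Y-tail (suc (suc s)))
                    (cong c (cong suc (trans (ℕP.+-suc q (suc s)) (cong suc (ℕP.+-suc q s))))))
        peak-up : c (suc (q + s)) < c (suc (suc (q + s)))
        peak-up = subst₂ _<_ colour₀ colour₁ up
        peak-down : c (suc (suc (suc (q + s)))) < c (suc (suc (q + s)))
        peak-down = subst₂ _<_ colour₂ colour₁ down
        s<r : s < r
        s<r = ℕP.≤-pred (ℕP.+-cancelˡ-≤ (suc D) (suc (suc s)) (suc r)
                (subst (_≤ suc (D + suc r)) j+3≡ j+3≤))

      reversed-valley : cu D < c 1 → ⊥
      reversed-valley cuD<c₁ = valley-lemma m′Y Y (s≤s z≤n) reversed-walk Y-negative-end
                                 (Y-ends-higher cuD<c₁) Y-rise-to-end Y-no-peak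

      resolve : Dec (c 1 ≤ cu D) → ⊥
      resolve (yes c₁≤cuD) = shorter X shortens (spliced-obstruction c₁≤cuD)
      resolve (no c₁≰cuD) = reversed-valley (ℕP.≰⇒> c₁≰cuD)

    impossible : ⊥
    impossible with good-length
    ... | D′ , good = ascending-chain K (suc D′) (good-length≤K good) (v q) (v (suc q)) peak-edge-shaved
                        λ chain → WithChain.resolve D′ good chain (c 1 ≤? col (AscendingChain.u chain) (suc D′))

  -- An obstruction without peaks is a valley; otherwise reduce at its last
  -- peak, using that shorter obstructions do not exist.
  reduce : ∀ m₂ v → Obstruction (suc (suc m₂)) v →
    (∀ {m′} v′ → m′ < suc (suc m₂) → Obstruction m′ v′ → ⊥) → ⊥
  reduce m₂ v ob shorter with greatest (λ j → IsPeak v (suc j)) (λ j → peak? v (suc j)) m₂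
  ... | inj₁ noPeak = valley-lemma (suc m₂) v (s≤s z≤n) O.walk (O.negative (suc (suc m₂)) (s≤s (s≤s z≤n)) ℕP.≤-refl)
                        O.ends-higher (λ j 1≤j j≤m → O.rises j (suc (suc m₂)) 1≤j j≤m ℕP.≤-refl)
                        (λ { (suc j) _ j+3≤m p → noPeak j (ℕP.≤-pred (ℕP.≤-pred j+3≤m)) p })
    where module O = Obstruction ob
  ... | inj₂ (i , i<m₂ , peak , after) with ℕP.m≤n⇒∃[o]m+o≡n i<m₂
  ...   | r , refl = LastPeak.impossible i r v ob peak after shorter

  no-obstruction : ∀ N {m} v → m ≤ N → Obstruction m v → ⊥
  no-obstruction N {zero} v _ ob with Obstruction.long ob
  ... | ()
  no-obstruction N {suc zero} v _ ob with Obstruction.long ob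
  ... | s≤s ()
  no-obstruction (suc N) {suc (suc m₂)} v (s≤s m≤N) ob =
    reduce m₂ v ob (λ v′ m′<m → no-obstruction N v′ (ℕP.≤-trans (ℕP.≤-pred m′<m) m≤N))

-- With K = k − 1: a walk in the K-shaving violating k-flatness would be an
-- obstruction, its rises being bounded by either flatness side condition.
lemma11 : (n : ℕ) (E : Rel n) (χ : Colouring n) (k : ℕ) →
    IsSimpleGraph E → IsProperColouring E χ → 1 ≤ k →
    (∀ k′ → 2 ≤ k′ → k′ ≤ k → ¬ HasFastWalk E χ k′) →
    IsFlat (shaveN χ (k ∸ 1) E) χ k
lemma11 n E χ (suc K) (E-sym , _) (χ-sym , χ-proper) _ no-fast m v 2≤m walk negative side =
  decidable-stable (colours χ v m <? colours χ v 1) λ ¬ends-lower →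
    no-obstruction m v ℕP.≤-refl record
      { long = 2≤m
      ; walk = walk-in-shaving K walk
      ; negative = negative
      ; ends-higher = ℕP.≮⇒≥ ¬ends-lower
      ; rises = [ rises-of-short-walk K c m 2≤m negative , rises-of-shallow-walk K c m negative ]′ side
      ; peaks-shaved = λ q _ q+2≤m _ → proj₁ walk (suc q) (s≤s z≤n) (ℕP.≤-trans (ℕP.n≤1+n (suc q)) q+2≤m) }
  where
  open Obstructions E χ E-sym χ-sym χ-proper K no-fast
  c : ℕ → ℕ
  c = colours χ v
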